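{- For each of the following pairs $(L,\ell)$ and every $\mathcal{L}(\Box,\mathbf{I})$-formula $A$, we have $L \vdash A$ if and only if $\ell \vdash A$: (1) $L \in \{\mathbf{IL}^-, \mathbf{IL}^-(\mathbf{J5})\}$, $\ell = \mathbf{il}^-$; (2) $L = \mathbf{IL}^-(\mathbf{J1})$, $\ell = \mathbf{il}^-(\mathbf{J1}^u)$; (3) $L \in \{\mathbf{IL}^-(\mathbf{J4}_+), \mathbf{IL}^-(\mathbf{J4}_+,\mathbf{J5}), \mathbf{IL}^-(\mathbf{J2}_+), \mathbf{IL}^-(\mathbf{J2},\mathbf{J4}_+)\}$, $\ell = \mathbf{il}^-(\mathbf{I2})$; (4) $L = \mathbf{IL}^-(\mathbf{J1},\mathbf{J5})$, $\ell = \mathbf{il}^-(\mathbf{J15}^u)$; (5) $L \in \{\mathbf{IL}^-(\mathbf{J1},\mathbf{J4}_+), \mathbf{CL}\}$, $\ell = \mathbf{il}^-(\mathbf{J1}^u,\mathbf{I2})$; (6) $L = \mathbf{IL}^-(\mathbf{J1},\mathbf{J4}_+,\mathbf{J5})$, $\ell = \mathbf{il}^-(\mathbf{J15}^u,\mathbf{I2})$; (7) $L = \mathbf{IL}^-(\mathbf{J2}_+,\mathbf{J5})$, $\ell = \mathbf{il}^-(\mathbf{I2},\mathbf{I3})$; (8) $L = \mathbf{IL}$, $\ell = \mathbf{il}^-(\mathbf{J1}^u,\mathbf{I2},\mathbf{I3})$; (9) $L \in \{\mathbf{IL}^-(\mathbf{J4}), \mathbf{IL}^-(\mathbf{J4},\mathbf{J5}),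 \mathbf{IL}^-(\mathbf{J2})\}$, $\ell = \mathbf{il}^-(\mathbf{I4})$; (10) $L = \mathbf{IL}^-(\mathbf{J1},\mathbf{J4})$, $\ell = \mathbf{il}^-(\mathbf{J1}^u,\mathbf{I4})$; (11) $L = \mathbf{IL}^-(\mathbf{J1},\mathbf{J4},\mathbf{J5})$, $\ell = \mathbf{il}^-(\mathbf{J15}^u,\mathbf{I4})$; (12) $L = \mathbf{IL}^-(\mathbf{J2},\mathbf{J5})$, $\ell = \mathbf{il}^-(\mathbf{J25}^u,\mathbf{I4})$; (13) $L = \mathbf{IL}^-(\mathbf{J2},\mathbf{J4}_+,\mathbf{J5})$, $\ell = \mathbf{il}^-(\mathbf{I2},\mathbf{J25}^u)$.
   Context: The language $\mathcal{L}(\Box,\rhd)$ consists of countably many propositional variables, $\bot$, $\to$, the unary modal operator $\Box$ and the binary modal operator $\rhd$; $\top,\neg,\land,\lor,\leftrightarrow$ are defined as usual and $\Diamond A :\equiv \neg\Box\neg A$. $\rhd$ binds weaker than $\neg,\land,\lor,\Box,\Diamond$ but stronger than $\to$. Put $\mathbf{I}A :\equiv \top \rhd A$. The language $\mathcal{L}(\Box,\mathbf{I})$ has formulas built from propositional variables and $\bot$ by $\to$, $\Box$ and $\mathbf{I}$; via the abbreviation these are also $\mathcal{L}(\Box,\rhd)$-formulas. The logic $\mathbf{IL}^-$ has as axioms all tautologies of $\mathcal{L}(\Box,\rhd)$, $\mathbf{G2}$: $\Box(A\to B)\to(\Box A\to\Box B)$, $\mathbf{G3}$: $\Box(\Box A\to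 A)\to\Box A$, $\mathbf{J3}$: $(A\rhd C)\land(B\rhd C)\to(A\lor B)\rhd C$, $\mathbf{J6}$: $\Box A\leftrightarrow(\neg A\rhd\bot)$; its rules are Modus Ponens, Necessitation ($A/\Box A$), $\mathbf{R1}$: from $A\to B$ infer $(C\rhd A)\to(C\rhd B)$, and $\mathbf{R2}$: from $A\to B$ infer $(B\rhd C)\to(A\rhd C)$. Further schemata: $\mathbf{J1}$: $\Box(A\to B)\to A\rhd B$; $\mathbf{J2}$: $(A\rhd B)\land(B\rhd C)\to A\rhd C$; $\mathbf{J2}_+$: $(A\rhd(B\lor C))\land(B\rhd C)\to A\rhd C$; $\mathbf{J4}$: $A\rhd B\to(\Diamond A\to\Diamond B)$; $\mathbf{J4}_+$: $\Box(A\to B)\to(C\rhd A\to C\rhd B)$; $\mathbf{J5}$: $\Diamond A\rhd A$. For a logic $L$ and schemata $\Sigma_1,\dots,\Sigma_k$, $L(\Sigma_1,\dots,\Sigma_k)$ is the logic obtained by adding these schemata as axioms (same rules). $\mathbf{CL} := \mathbf{IL}^-(\mathbf{J1},\mathbf{J2}_+)$ and $\mathbf{IL} := \mathbf{IL}^-(\mathbf{J1},\mathbf{J2}_+,\mathbf{J5})$. The logic $\mathbf{il}^-$ has as axioms all tautologies of $\mathcal{L}(\Box,\mathbf{I})$, $\mathbf{G2}$, $\mathbf{G3}$ (for $\mathcal{L}(\Box,\mathbf{I})$-formulas) and $\mathbf{J6}^u$: $\Box\bot\leftrightarrow\mathbf{I}\bot$; its rules are Modus Ponens, Necessitation and $\mathbf{R}^u$: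 from $A\to B$ infer $\mathbf{I}A\to\mathbf{I}B$. Further schemata: $\mathbf{I2}$: $\Box(A\to B)\to(\mathbf{I}A\to\mathbf{I}B)$; $\mathbf{I3}$: $\mathbf{I}(A\lor\Diamond A)\to\mathbf{I}A$; $\mathbf{I4}$: $\mathbf{I}A\land\Diamond\top\to\Diamond A$; $\mathbf{J1}^u$: $\Box A\to\mathbf{I}A$; $\mathbf{J15}^u$: $\Box(A\lor\Diamond A)\to\mathbf{I}A$; $\mathbf{J25}^u$: $\Box(A\to\Diamond B)\to(\mathbf{I}A\to\mathbf{I}B)$. $\mathbf{il}^-(\Sigma_1,\dots,\Sigma_k)$ is defined analogously. -}

module Defs where

open import Data.Nat using (ℕ)
open import Data.Bool using (Bool; true; false; _∧_; not; _∨_)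
open import Data.Product using (_×_)
open import Relation.Binary.PropositionalEquality using (_≡_)
open import Relation.Unary using (Pred; _∪_; ∅)
open import Level using (0ℓ)

infixr 4 _⇒_
infixr 4 _⇒ᵘ_
infix 5 _▷_
infixl 6 _∨'_ _∧'_ _∨ᵘ_ _∧ᵘ_

data Fm : Set where
  var : ℕ → Fm
  ⊥'  : Fm
  _⇒_ : Fm → Fm → Fm
  □   : Fm → Fm
  _▷_ : Fm → Fm → Fm

¬' : Fm → Fm
¬' A = A ⇒ ⊥'

⊤' : Fm
⊤' = ¬' ⊥'

_∨'_ : Fm → Fm → Fm
A ∨' B = ¬' A ⇒ B

_∧'_ : Fm → Fm → Fm
A ∧' B = ¬' (A ⇒ ¬' B)

_⇔'_ : Fm → Fm → Fm
A ⇔' B = (A ⇒ B) ∧' (B ⇒ A)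

◇ : Fm → Fm
◇ A = ¬' (□ (¬' A))

eval : (Fm → Bool) → Fm → Bool
eval v (var p) = v (var p)
eval v ⊥'      = false
eval v (A ⇒ B) = not (eval v A) ∨ eval v B
eval v (□ A)   = v (□ A)
eval v (A ▷ B) = v (A ▷ B)

-- A is a tautology (an instance of a propositional tautology).
Taut : Fm → Set
Taut A = ∀ (v : Fm → Bool) → eval v A ≡ true

Schema : Set₁
Schema = Pred Fm 0ℓ

data J1 : Fm → Set where
  j1 : ∀ A B → J1 (□ (A ⇒ B) ⇒ A ▷ B)

data J2 : Fm → Set where
  j2 : ∀ A B C → J2 ((A ▷ B) ∧' (B ▷ C) ⇒ A ▷ C)

data J2₊ : Fm → Set where
  j2₊ : ∀ A B C → J2₊ ((A ▷ (B ∨' C)) ∧' (B ▷ C) ⇒ A ▷ C)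

data J4 : Fm → Set where
  j4 : ∀ A B → J4 (A ▷ B ⇒ (◇ A ⇒ ◇ B))

data J4₊ : Fm → Set where
  j4₊ : ∀ A B C → J4₊ (□ (A ⇒ B) ⇒ (C ▷ A ⇒ C ▷ B))

data J5 : Fm → Set where
  j5 : ∀ A → J5 (◇ A ▷ A)

-- Derivability in IL⁻ extended by the extra axioms Ax.
data _⊢_ (Ax : Schema) : Fm → Set where
  taut : ∀ {A} → Taut A → Ax ⊢ A
  G2   : ∀ A B → Ax ⊢ (□ (A ⇒ B) ⇒ (□ A ⇒ □ B))
  G3   : ∀ A → Ax ⊢ (□ (□ A ⇒ A) ⇒ □ A)
  J3   : ∀ A B C → Ax ⊢ ((A ▷ C) ∧' (B ▷ C) ⇒ (A ∨' B) ▷ C)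
  J6   : ∀ A → Ax ⊢ (□ A ⇔' (¬' A ▷ ⊥'))
  ax   : ∀ {A} → Ax A → Ax ⊢ A
  mp   : ∀ {A B} → Ax ⊢ (A ⇒ B) → Ax ⊢ A → Ax ⊢ B
  nec  : ∀ {A} → Ax ⊢ A → Ax ⊢ □ A
  R1   : ∀ {A B} C → Ax ⊢ (A ⇒ B) → Ax ⊢ (C ▷ A ⇒ C ▷ B)
  R2   : ∀ {A B} C → Ax ⊢ (A ⇒ B) → Ax ⊢ (B ▷ C ⇒ A ▷ C)

-- Named logics: IL⁻(Σ₁,…,Σk) = ( Σ₁ ∪ … ∪ Σk ) ⊢_
IL⁻ : Schema
IL⁻ = ∅

CL : Schema
CL = J1 ∪ J2₊

IL : Schema
IL = J1 ∪ J2₊ ∪ J5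

data Fmᵘ : Set where
  var  : ℕ → Fmᵘ
  ⊥ᵘ   : Fmᵘ
  _⇒ᵘ_ : Fmᵘ → Fmᵘ → Fmᵘ
  □ᵘ   : Fmᵘ → Fmᵘ
  I    : Fmᵘ → Fmᵘ

¬ᵘ : Fmᵘ → Fmᵘ
¬ᵘ A = A ⇒ᵘ ⊥ᵘ

⊤ᵘ : Fmᵘ
⊤ᵘ = ¬ᵘ ⊥ᵘ

_∨ᵘ_ : Fmᵘ → Fmᵘ → Fmᵘ
A ∨ᵘ B = ¬ᵘ A ⇒ᵘ B

_∧ᵘ_ : Fmᵘ → Fmᵘ → Fmᵘ
A ∧ᵘ B = ¬ᵘ (A ⇒ᵘ ¬ᵘ B)

_⇔ᵘ_ : Fmᵘ → Fmᵘ → Fmᵘ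
A ⇔ᵘ B = (A ⇒ᵘ B) ∧ᵘ (B ⇒ᵘ A)

◇ᵘ : Fmᵘ → Fmᵘ
◇ᵘ A = ¬ᵘ (□ᵘ (¬ᵘ A))

evalᵘ : (Fmᵘ → Bool) → Fmᵘ → Bool
evalᵘ v (var p)  = v (var p)
evalᵘ v ⊥ᵘ       = false
evalᵘ v (A ⇒ᵘ B) = not (evalᵘ v A) ∨ evalᵘ v B
evalᵘ v (□ᵘ A)   = v (□ᵘ A)
evalᵘ v (I A)    = v (I A)

Tautᵘ : Fmᵘ → Set
Tautᵘ A = ∀ (v : Fmᵘ → Bool) → evalᵘ v A ≡ true

Schemaᵘ : Set₁
Schemaᵘ = Pred Fmᵘ 0ℓ

data I2 : Fmᵘ → Set where
  i2 : ∀ A B → I2 (□ᵘ (A ⇒ᵘ B) ⇒ᵘ (I A ⇒ᵘ I B))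

data I3 : Fmᵘ → Set where
  i3 : ∀ A → I3 (I (A ∨ᵘ ◇ᵘ A) ⇒ᵘ I A)

data I4 : Fmᵘ → Set where
  i4 : ∀ A → I4 (I A ∧ᵘ ◇ᵘ ⊤ᵘ ⇒ᵘ ◇ᵘ A)

data J1ᵘ : Fmᵘ → Set where
  j1ᵘ : ∀ A → J1ᵘ (□ᵘ A ⇒ᵘ I A)

data J15ᵘ : Fmᵘ → Set where
  j15ᵘ : ∀ A → J15ᵘ (□ᵘ (A ∨ᵘ ◇ᵘ A) ⇒ᵘ I A)

data J25ᵘ : Fmᵘ → Set where
  j25ᵘ : ∀ A B → J25ᵘ (□ᵘ (A ⇒ᵘ ◇ᵘ B) ⇒ᵘ (I A ⇒ᵘ I B))

-- Derivability in il⁻ extended by the extra axioms Ax.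
data _⊢ᵘ_ (Ax : Schemaᵘ) : Fmᵘ → Set where
  taut : ∀ {A} → Tautᵘ A → Ax ⊢ᵘ A
  G2   : ∀ A B → Ax ⊢ᵘ (□ᵘ (A ⇒ᵘ B) ⇒ᵘ (□ᵘ A ⇒ᵘ □ᵘ B))
  G3   : ∀ A → Ax ⊢ᵘ (□ᵘ (□ᵘ A ⇒ᵘ A) ⇒ᵘ □ᵘ A)
  J6ᵘ  : Ax ⊢ᵘ (□ᵘ ⊥ᵘ ⇔ᵘ I ⊥ᵘ)
  ax   : ∀ {A} → Ax A → Ax ⊢ᵘ A
  mp   : ∀ {A B} → Ax ⊢ᵘ (A ⇒ᵘ B) → Ax ⊢ᵘ A → Ax ⊢ᵘ B
  nec  : ∀ {A} → Ax ⊢ᵘ A → Ax ⊢ᵘ □ᵘ A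
  Rᵘ   : ∀ {A B} → Ax ⊢ᵘ (A ⇒ᵘ B) → Ax ⊢ᵘ (I A ⇒ᵘ I B)

il⁻ : Schemaᵘ
il⁻ = ∅

emb : Fmᵘ → Fm
emb (var p)  = var p
emb ⊥ᵘ       = ⊥'
emb (A ⇒ᵘ B) = emb A ⇒ emb B
emb (□ᵘ A)   = □ (emb A)
emb (I A)    = ⊤' ▷ emb A

Agree : Schema → Schemaᵘ → Set
Agree L ℓ = ∀ (A : Fmᵘ) → ((L ⊢ emb A) → (ℓ ⊢ᵘ A)) × ((ℓ ⊢ᵘ A) → (L ⊢ emb A))

-- The embedding I A := ⊤ ▷ A sends ℓ into L because every extra axiom of ℓ is
-- derivable in L. Conversely, read A ▷ B as I B ∨ □(A → X B), where X is one of
-- ⊥, id, ◇ or id ∨ ◇ according to which of J1 and J5 the logic L contains.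
-- This translation carries L-theorems to ℓ-theorems, and on L(□,I)-formulas it
-- undoes the embedding up to ℓ-equivalence: ⊤ ▷ A becomes I A ∨ □ X A, and
-- □ X A ⇒ I A holds in ℓ for the chosen X.
module Submission where

open import Defs
open import Data.Bool using (Bool; true; false; _∧_; _∨_; not; T)
open import Data.Bool.Properties using (T-∧; T-≡)
open import Data.Fin using (Fin; #_)
open import Data.Nat using (ℕ; zero; suc; _<?_)
open import Data.Product using (_×_; _,_; proj₁; proj₂)
open import Data.Sum using (inj₁; inj₂; [_,_])
open import Data.Vec using (Vec; []; _∷_; lookup; map)
open import Data.Vec.Properties using (lookup-map)
open import Function using (_∘_; id; const; Equivalence)
open import Relation.Binary.PropositionalEquality using (_≡_; refl; sym; trans; cong₂)
open import Relation.Nullary.Decidable using (True)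
open import Relation.Unary using (_∪_; _⊆_)

variable
  a b c : Fmᵘ
  A B C : Fm

-- Propositional tautologies by truth tables

infixr 4 _⟶_
infix  5 _⇔ₛ_
infixl 6 _∨ₛ_ _∧ₛ_
infixr 9 ¬ₛ_
infix  10 ‵_

data Skel (n : ℕ) : Set where
  at  : Fin n → Skel n
  ff  : Skel n
  _⟶_ : Skel n → Skel n → Skel n

‵_ : ∀ m {n} {m<n : True (m <? n)} → Skel n
‵_ m {m<n = m<n} = at (#_ m {m<n = m<n})

¬ₛ_ : ∀ {n} → Skel n → Skel n
¬ₛ p = p ⟶ ff

_∨ₛ_ _∧ₛ_ _⇔ₛ_ : ∀ {n} → Skel n → Skel n → Skel n
p ∨ₛ q = ¬ₛ p ⟶ q
p ∧ₛ q = ¬ₛ (p ⟶ ¬ₛ q)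
p ⇔ₛ q = (p ⟶ q) ∧ₛ (q ⟶ p)

⟦_⟧ : ∀ {n} → Skel n → Vec Bool n → Bool
⟦ at i ⟧  w = lookup w i
⟦ ff ⟧    w = false
⟦ p ⟶ q ⟧ w = not (⟦ p ⟧ w) ∨ ⟦ q ⟧ w

valid : ∀ n → (Vec Bool n → Bool) → Bool
valid zero    f = f []
valid (suc n) f = valid n (f ∘ (true ∷_)) ∧ valid n (f ∘ (false ∷_))

valid-sound : ∀ n f → T (valid n f) → ∀ w → f w ≡ true
valid-sound zero    f ok []          = Equivalence.to T-≡ ok
valid-sound (suc n) f ok (true ∷ w)  = valid-sound n _ (proj₁ (Equivalence.to T-∧ ok)) w
valid-sound (suc n) f ok (false ∷ w) = valid-sound n _ (proj₂ (Equivalence.to T-∧ ok)) w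

module Instances {F : Set} (⊥F : F) (_⇒F_ : F → F → F) (ev : (F → Bool) → F → Bool)
  (ev-⊥ : ∀ v → ev v ⊥F ≡ false)
  (ev-⇒ : ∀ v x y → ev v (x ⇒F y) ≡ not (ev v x) ∨ ev v y) where

  infix 30 _[_]

  _[_] : ∀ {n} → Skel n → Vec F n → F
  at i    [ σ ] = lookup σ i
  ff      [ σ ] = ⊥F
  (p ⟶ q) [ σ ] = p [ σ ] ⇒F q [ σ ]

  ev-[] : ∀ {n} v (p : Skel n) σ → ev v (p [ σ ]) ≡ ⟦ p ⟧ (map (ev v) σ)
  ev-[] v (at i)  σ = sym (lookup-map i (ev v) σ)
  ev-[] v ff      σ = ev-⊥ v
  ev-[] v (p ⟶ q) σ = trans (ev-⇒ v _ _) (cong₂ (λ x y → not x ∨ y) (ev-[] v p σ) (ev-[] v q σ))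

  valid-[] : ∀ {n} (p : Skel n) σ → T (valid n ⟦ p ⟧) → ∀ v → ev v (p [ σ ]) ≡ true
  valid-[] p σ ok v = trans (ev-[] v p σ) (valid-sound _ _ ok (map (ev v) σ))

module Instᵘ = Instances ⊥ᵘ _⇒ᵘ_ evalᵘ (λ _ → refl) (λ _ _ _ → refl)
module Inst' = Instances ⊥' _⇒_ eval (λ _ → refl) (λ _ _ _ → refl)

-- For a closed skeleton the truth-table check computes to true, so the
-- implicit argument, of type T true = ⊤, is filled in by eta.
tautᵘ : ∀ {ℓ n} (σ : Vec Fmᵘ n) (p : Skel n) {_ : T (valid n ⟦ p ⟧)} → ℓ ⊢ᵘ p Instᵘ.[ σ ]
tautᵘ σ p {ok} = taut (Instᵘ.valid-[] p σ ok)

taut' : ∀ {L n} (σ : Vec Fm n) (p : Skel n) {_ : T (valid n ⟦ p ⟧)} → L ⊢ p Inst'.[ σ ]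
taut' σ p {ok} = taut (Inst'.valid-[] p σ ok)

module _ {ℓ : Schemaᵘ} where

  infixl 2 _·_
  _·_ : ℓ ⊢ᵘ (a ⇒ᵘ b) → ℓ ⊢ᵘ a → ℓ ⊢ᵘ b
  _·_ = mp

  ⇒-trans : ℓ ⊢ᵘ (a ⇒ᵘ b) → ℓ ⊢ᵘ (b ⇒ᵘ c) → ℓ ⊢ᵘ (a ⇒ᵘ c)
  ⇒-trans {a} {b} {c} f g = tautᵘ (a ∷ b ∷ c ∷ []) ((‵ 0 ⟶ ‵ 1) ⟶ (‵ 1 ⟶ ‵ 2) ⟶ ‵ 0 ⟶ ‵ 2) · f · g

  □-mono : ℓ ⊢ᵘ (a ⇒ᵘ b) → ℓ ⊢ᵘ (□ᵘ a ⇒ᵘ □ᵘ b)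
  □-mono h = G2 _ _ · nec h

  □-mono₂ : ℓ ⊢ᵘ (a ⇒ᵘ b ⇒ᵘ c) → ℓ ⊢ᵘ (□ᵘ a ⇒ᵘ □ᵘ b ⇒ᵘ □ᵘ c)
  □-mono₂ h = ⇒-trans (□-mono h) (G2 _ _)

  -- Löb's axiom for a ∧ □a.
  □-4 : ∀ a → ℓ ⊢ᵘ (□ᵘ a ⇒ᵘ □ᵘ (□ᵘ a))
  □-4 a = ⇒-trans (□-mono lift) (⇒-trans (G3 (a ∧ᵘ □ᵘ a)) (□-mono (tautᵘ (a ∷ □ᵘ a ∷ []) (‵ 0 ∧ₛ ‵ 1 ⟶ ‵ 1))))
    where
    lift : ℓ ⊢ᵘ (a ⇒ᵘ □ᵘ (a ∧ᵘ □ᵘ a) ⇒ᵘ a ∧ᵘ □ᵘ a)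
    lift = tautᵘ (a ∷ □ᵘ (a ∧ᵘ □ᵘ a) ∷ □ᵘ a ∷ []) ((‵ 1 ⟶ ‵ 2) ⟶ ‵ 0 ⟶ ‵ 1 ⟶ ‵ 0 ∧ₛ ‵ 2)
         · □-mono (tautᵘ (a ∷ □ᵘ a ∷ []) (‵ 0 ∧ₛ ‵ 1 ⟶ ‵ 0))

  □-mono-4 : ℓ ⊢ᵘ (a ⇒ᵘ □ᵘ a ⇒ᵘ b) → ℓ ⊢ᵘ (□ᵘ a ⇒ᵘ □ᵘ b)
  □-mono-4 {a} {b} h =
    tautᵘ (□ᵘ a ∷ □ᵘ (□ᵘ a) ∷ □ᵘ b ∷ []) ((‵ 0 ⟶ ‵ 1) ⟶ (‵ 0 ⟶ ‵ 1 ⟶ ‵ 2) ⟶ ‵ 0 ⟶ ‵ 2)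
    · □-4 a · □-mono₂ h

  ◇-K : ∀ a b → ℓ ⊢ᵘ (□ᵘ (a ⇒ᵘ b) ⇒ᵘ ◇ᵘ a ⇒ᵘ ◇ᵘ b)
  ◇-K a b =
    tautᵘ (□ᵘ (a ⇒ᵘ b) ∷ □ᵘ (¬ᵘ b ⇒ᵘ ¬ᵘ a) ∷ □ᵘ (¬ᵘ b) ∷ □ᵘ (¬ᵘ a) ∷ [])
          ((‵ 0 ⟶ ‵ 1) ⟶ (‵ 1 ⟶ ‵ 2 ⟶ ‵ 3) ⟶ ‵ 0 ⟶ ¬ₛ ‵ 3 ⟶ ¬ₛ ‵ 2)
    · □-mono (tautᵘ (a ∷ b ∷ []) ((‵ 0 ⟶ ‵ 1) ⟶ ¬ₛ ‵ 1 ⟶ ¬ₛ ‵ 0))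
    · G2 (¬ᵘ b) (¬ᵘ a)

  ◇-mono : ℓ ⊢ᵘ (a ⇒ᵘ b) → ℓ ⊢ᵘ (◇ᵘ a ⇒ᵘ ◇ᵘ b)
  ◇-mono h = ◇-K _ _ · nec h

  ◇-4 : ∀ a → ℓ ⊢ᵘ (◇ᵘ (◇ᵘ a) ⇒ᵘ ◇ᵘ a)
  ◇-4 a =
    tautᵘ (□ᵘ (¬ᵘ a) ∷ □ᵘ (□ᵘ (¬ᵘ a)) ∷ □ᵘ (¬ᵘ (◇ᵘ a)) ∷ []) ((‵ 0 ⟶ ‵ 1) ⟶ (‵ 1 ⟶ ‵ 2) ⟶ ¬ₛ ‵ 2 ⟶ ¬ₛ ‵ 0)
    · □-4 (¬ᵘ a) · □-mono (tautᵘ (□ᵘ (¬ᵘ a) ∷ []) (‵ 0 ⟶ ¬ₛ ¬ₛ ‵ 0))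

  ◇-∨ : ∀ a b → ℓ ⊢ᵘ (◇ᵘ (a ∨ᵘ b) ⇒ᵘ ◇ᵘ a ∨ᵘ ◇ᵘ b)
  ◇-∨ a b =
    tautᵘ (□ᵘ (¬ᵘ a) ∷ □ᵘ (¬ᵘ b) ∷ □ᵘ (¬ᵘ (a ∨ᵘ b)) ∷ []) ((‵ 0 ⟶ ‵ 1 ⟶ ‵ 2) ⟶ ¬ₛ ‵ 2 ⟶ ¬ₛ ‵ 0 ∨ₛ ¬ₛ ‵ 1)
    · □-mono₂ (tautᵘ (a ∷ b ∷ []) (¬ₛ ‵ 0 ⟶ ¬ₛ ‵ 1 ⟶ ¬ₛ (‵ 0 ∨ₛ ‵ 1)))

  ¬◇⊥ : ℓ ⊢ᵘ (◇ᵘ ⊥ᵘ ⇒ᵘ ⊥ᵘ)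
  ¬◇⊥ = tautᵘ (□ᵘ ⊤ᵘ ∷ []) (‵ 0 ⟶ ¬ₛ ‵ 0 ⟶ ff) · nec (tautᵘ [] (ff ⟶ ff))

  I⊥⇒□⊥ : ℓ ⊢ᵘ (I ⊥ᵘ ⇒ᵘ □ᵘ ⊥ᵘ)
  I⊥⇒□⊥ = tautᵘ (□ᵘ ⊥ᵘ ∷ I ⊥ᵘ ∷ []) (‵ 0 ⇔ₛ ‵ 1 ⟶ ‵ 1 ⟶ ‵ 0) · J6ᵘ

  □⊥⇒I : ∀ c → ℓ ⊢ᵘ (□ᵘ ⊥ᵘ ⇒ᵘ I c)
  □⊥⇒I c = ⇒-trans (tautᵘ (□ᵘ ⊥ᵘ ∷ I ⊥ᵘ ∷ []) (‵ 0 ⇔ₛ ‵ 1 ⟶ ‵ 0 ⟶ ‵ 1) · J6ᵘ) (Rᵘ (tautᵘ (c ∷ []) (ff ⟶ ‵ 0)))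

  -- ◇c refutes □⊥, so Löb's axiom for ⊥ applies under □.
  □◇⇒□⊥ : ∀ c → ℓ ⊢ᵘ (□ᵘ (◇ᵘ c) ⇒ᵘ □ᵘ ⊥ᵘ)
  □◇⇒□⊥ c = ⇒-trans (□-mono ◇⇒¬□⊥) (G3 ⊥ᵘ)
    where
    ◇⇒¬□⊥ : ℓ ⊢ᵘ (◇ᵘ c ⇒ᵘ □ᵘ ⊥ᵘ ⇒ᵘ ⊥ᵘ)
    ◇⇒¬□⊥ = tautᵘ (□ᵘ ⊥ᵘ ∷ □ᵘ (¬ᵘ c) ∷ []) ((‵ 0 ⟶ ‵ 1) ⟶ ¬ₛ ‵ 1 ⟶ ‵ 0 ⟶ ff)
          · □-mono (tautᵘ (c ∷ []) (ff ⟶ ¬ₛ ‵ 0))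

module _ {L : Schema} where

  infixl 2 _·'_
  _·'_ : L ⊢ (A ⇒ B) → L ⊢ A → L ⊢ B
  _·'_ = mp

  ⇒-trans' : L ⊢ (A ⇒ B) → L ⊢ (B ⇒ C) → L ⊢ (A ⇒ C)
  ⇒-trans' {A} {B} {C} f g = taut' (A ∷ B ∷ C ∷ []) ((‵ 0 ⟶ ‵ 1) ⟶ (‵ 1 ⟶ ‵ 2) ⟶ ‵ 0 ⟶ ‵ 2) ·' f ·' g

  □-mono' : L ⊢ (A ⇒ B) → L ⊢ (□ A ⇒ □ B)
  □-mono' h = G2 _ _ ·' nec h

  □⇒▷⊥ : ∀ A → L ⊢ (□ A ⇒ ¬' A ▷ ⊥')
  □⇒▷⊥ A = taut' (□ A ∷ (¬' A ▷ ⊥') ∷ []) (‵ 0 ⇔ₛ ‵ 1 ⟶ ‵ 0 ⟶ ‵ 1) ·' J6 A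

  ▷⊥⇒□ : ∀ A → L ⊢ (¬' A ▷ ⊥' ⇒ □ A)
  ▷⊥⇒□ A = taut' (□ A ∷ (¬' A ▷ ⊥') ∷ []) (‵ 0 ⇔ₛ ‵ 1 ⟶ ‵ 1 ⟶ ‵ 0) ·' J6 A

  □⇒▷ : ∀ A B → L ⊢ (□ A ⇒ ¬' A ▷ B)
  □⇒▷ A B = ⇒-trans' (□⇒▷⊥ A) (R1 (¬' A) (taut' (B ∷ []) (ff ⟶ ‵ 0)))

Derives : Schema → Schema → Set
Derives L Σ = ∀ {A} → Σ A → L ⊢ A

Derivesᵘ : Schemaᵘ → Schemaᵘ → Set
Derivesᵘ ℓ σ = ∀ {a} → σ a → ℓ ⊢ᵘ a

DerivesEmb : Schema → Schemaᵘ → Set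
DerivesEmb L σ = ∀ {a} → σ a → L ⊢ emb a

axiom : ∀ {L Σ} → Σ ⊆ L → Derives L Σ
axiom sub h = ax (sub h)

axiomᵘ : ∀ {ℓ σ} → σ ⊆ ℓ → Derivesᵘ ℓ σ
axiomᵘ sub h = ax (sub h)

infixr 1 _∪ᵉ_
_∪ᵉ_ : ∀ {L σ σ′} → DerivesEmb L σ → DerivesEmb L σ′ → DerivesEmb L (σ ∪ σ′)
f ∪ᵉ g = [ f , g ]

emb-eval : ∀ v a → eval v (emb a) ≡ evalᵘ (eval v ∘ emb) a
emb-eval v (var p)  = refl
emb-eval v ⊥ᵘ       = refl
emb-eval v (a ⇒ᵘ b) = cong₂ (λ x y → not x ∨ y) (emb-eval v a) (emb-eval v b)
emb-eval v (□ᵘ a)   = refl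
emb-eval v (I a)    = refl

emb-sound : ∀ {L ℓ} → DerivesEmb L ℓ → ℓ ⊢ᵘ a → L ⊢ emb a
emb-sound axs (taut {a} t) = taut (λ v → trans (emb-eval v a) (t _))
emb-sound axs (G2 a b)     = G2 _ _
emb-sound axs (G3 a)       = G3 _
emb-sound axs J6ᵘ          = J6 ⊥'
emb-sound axs (ax h)       = axs h
emb-sound axs (mp d e)     = mp (emb-sound axs d) (emb-sound axs e)
emb-sound axs (nec d)      = nec (emb-sound axs d)
emb-sound axs (Rᵘ d)       = R1 ⊤' (emb-sound axs d)

module _ {L : Schema} where

  J1ᵘ-emb : Derives L J1 → DerivesEmb L J1ᵘ
  J1ᵘ-emb ⊢J1 (j1ᵘ a) = ⇒-trans' (□-mono' (taut' (emb a ∷ []) (‵ 0 ⟶ ¬ₛ ff ⟶ ‵ 0))) (⊢J1 (j1 ⊤' (emb a)))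

  I2-emb-J4₊ : Derives L J4₊ → DerivesEmb L I2
  I2-emb-J4₊ ⊢J4₊ (i2 a b) = ⊢J4₊ (j4₊ (emb a) (emb b) ⊤')

  I2-of-J2₊ : Derives L J2₊ → L ⊢ (□ (A ⇒ B) ⇒ ⊤' ▷ A ⇒ ⊤' ▷ B)
  I2-of-J2₊ {A} {B} ⊢J2₊ =
    taut' (□ (A ⇒ B) ∷ (N ▷ B) ∷ (⊤' ▷ A) ∷ (⊤' ▷ (N ∨' B)) ∷ (⊤' ▷ B) ∷ [])
          ((‵ 0 ⟶ ‵ 1) ⟶ (‵ 2 ⟶ ‵ 3) ⟶ (‵ 3 ∧ₛ ‵ 1 ⟶ ‵ 4) ⟶ ‵ 0 ⟶ ‵ 2 ⟶ ‵ 4)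
    ·' □⇒▷ (A ⇒ B) B
    ·' R1 ⊤' (taut' (A ∷ B ∷ []) (‵ 0 ⟶ ¬ₛ ¬ₛ (‵ 0 ⟶ ‵ 1) ⟶ ‵ 1))
    ·' ⊢J2₊ (j2₊ ⊤' N B)
    where
    N : Fm
    N = ¬' (A ⇒ B)

  I2-emb-J2₊ : Derives L J2₊ → DerivesEmb L I2
  I2-emb-J2₊ ⊢J2₊ (i2 _ _) = I2-of-J2₊ ⊢J2₊

  I3-of-J2₊-J5 : Derives L J2₊ → Derives L J5 → L ⊢ (⊤' ▷ (A ∨' ◇ A) ⇒ ⊤' ▷ A)
  I3-of-J2₊-J5 {A} ⊢J2₊ ⊢J5 =
    taut' ((⊤' ▷ (A ∨' ◇ A)) ∷ (⊤' ▷ (◇ A ∨' A)) ∷ (◇ A ▷ A) ∷ (⊤' ▷ A) ∷ [])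
          ((‵ 0 ⟶ ‵ 1) ⟶ ‵ 2 ⟶ (‵ 1 ∧ₛ ‵ 2 ⟶ ‵ 3) ⟶ ‵ 0 ⟶ ‵ 3)
    ·' R1 ⊤' (taut' (A ∷ □ (¬' A) ∷ []) (‵ 0 ∨ₛ ¬ₛ ‵ 1 ⟶ ¬ₛ ‵ 1 ∨ₛ ‵ 0))
    ·' ⊢J5 (j5 A)
    ·' ⊢J2₊ (j2₊ ⊤' (◇ A) A)

  I3-emb : Derives L J2₊ → Derives L J5 → DerivesEmb L I3
  I3-emb ⊢J2₊ ⊢J5 (i3 _) = I3-of-J2₊-J5 ⊢J2₊ ⊢J5

  -- ⊤ is covered by ¬(A ∨ ◇A), A and ◇A, each of which interprets A.
  J15ᵘ-of-J1-J5 : Derives L J1 → Derives L J5 → L ⊢ (□ (A ∨' ◇ A) ⇒ ⊤' ▷ A)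
  J15ᵘ-of-J1-J5 {A} ⊢J1 ⊢J5 =
    taut' (□ (A ∨' ◇ A) ∷ (N ▷ A) ∷ (A ▷ A) ∷ (◇ A ▷ A) ∷ ((N ∨' A) ▷ A) ∷ (((N ∨' A) ∨' ◇ A) ▷ A) ∷ (⊤' ▷ A) ∷ [])
          ((‵ 0 ⟶ ‵ 1) ⟶ ‵ 2 ⟶ ‵ 3 ⟶ (‵ 1 ∧ₛ ‵ 2 ⟶ ‵ 4) ⟶ (‵ 4 ∧ₛ ‵ 3 ⟶ ‵ 5) ⟶ (‵ 5 ⟶ ‵ 6) ⟶ ‵ 0 ⟶ ‵ 6)
    ·' □⇒▷ (A ∨' ◇ A) A
    ·' (⊢J1 (j1 A A) ·' nec (taut' (A ∷ []) (‵ 0 ⟶ ‵ 0)))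
    ·' ⊢J5 (j5 A)
    ·' J3 N A A
    ·' J3 (N ∨' A) (◇ A) A
    ·' R2 A (taut' (A ∷ □ (¬' A) ∷ []) (¬ₛ ff ⟶ (¬ₛ (‵ 0 ∨ₛ ¬ₛ ‵ 1) ∨ₛ ‵ 0) ∨ₛ ¬ₛ ‵ 1))
    where
    N : Fm
    N = ¬' (A ∨' ◇ A)

  J15ᵘ-emb : Derives L J1 → Derives L J5 → DerivesEmb L J15ᵘ
  J15ᵘ-emb ⊢J1 ⊢J5 (j15ᵘ _) = J15ᵘ-of-J1-J5 ⊢J1 ⊢J5

  I4-emb-J4 : Derives L J4 → DerivesEmb L I4
  I4-emb-J4 ⊢J4 (i4 a) =
    taut' ((⊤' ▷ emb a) ∷ ◇ ⊤' ∷ ◇ (emb a) ∷ []) ((‵ 0 ⟶ ‵ 1 ⟶ ‵ 2) ⟶ ‵ 0 ∧ₛ ‵ 1 ⟶ ‵ 2) ·' ⊢J4 (j4 ⊤' (emb a))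

  -- If □¬A then A ▷ ⊥, so ⊤ ▷ A gives ⊤ ▷ ⊥, i.e. □⊥.
  I4-of-J2 : Derives L J2 → L ⊢ ((⊤' ▷ A) ∧' ◇ ⊤' ⇒ ◇ A)
  I4-of-J2 {A} ⊢J2 =
    taut' ((⊤' ▷ A) ∷ □ (¬' ⊤') ∷ □ (¬' A) ∷ (¬' (¬' A) ▷ ⊥') ∷ (A ▷ ⊥') ∷ (⊤' ▷ ⊥') ∷ □ ⊥' ∷ [])
          ((‵ 2 ⟶ ‵ 3) ⟶ (‵ 3 ⟶ ‵ 4) ⟶ (‵ 0 ∧ₛ ‵ 4 ⟶ ‵ 5) ⟶ (‵ 5 ⟶ ‵ 6) ⟶ (‵ 6 ⟶ ‵ 1) ⟶ ‵ 0 ∧ₛ ¬ₛ ‵ 1 ⟶ ¬ₛ ‵ 2)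
    ·' □⇒▷⊥ (¬' A)
    ·' R2 ⊥' (taut' (A ∷ []) (‵ 0 ⟶ ¬ₛ ¬ₛ ‵ 0))
    ·' ⊢J2 (j2 ⊤' A ⊥')
    ·' ▷⊥⇒□ ⊥'
    ·' □-mono' (taut' [] (ff ⟶ ¬ₛ ¬ₛ ff))

  I4-emb-J2 : Derives L J2 → DerivesEmb L I4
  I4-emb-J2 ⊢J2 (i4 _) = I4-of-J2 ⊢J2

  J25ᵘ-of-J2-J5 : Derives L J2 → Derives L J5 → L ⊢ (□ (A ⇒ ◇ B) ⇒ ⊤' ▷ A ⇒ ⊤' ▷ B)
  J25ᵘ-of-J2-J5 {A} {B} ⊢J2 ⊢J5 =
    taut' (□ (A ⇒ ◇ B) ∷ (N ▷ B) ∷ (◇ B ▷ B) ∷ ((N ∨' ◇ B) ▷ B) ∷ (⊤' ▷ A) ∷ (⊤' ▷ (N ∨' ◇ B)) ∷ (⊤' ▷ B) ∷ [])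
          ((‵ 0 ⟶ ‵ 1) ⟶ ‵ 2 ⟶ (‵ 1 ∧ₛ ‵ 2 ⟶ ‵ 3) ⟶ (‵ 4 ⟶ ‵ 5) ⟶ (‵ 5 ∧ₛ ‵ 3 ⟶ ‵ 6) ⟶ ‵ 0 ⟶ ‵ 4 ⟶ ‵ 6)
    ·' □⇒▷ (A ⇒ ◇ B) B
    ·' ⊢J5 (j5 B)
    ·' J3 N (◇ B) B
    ·' R1 ⊤' (taut' (A ∷ □ (¬' B) ∷ []) (‵ 0 ⟶ ¬ₛ (‵ 0 ⟶ ¬ₛ ‵ 1) ∨ₛ ¬ₛ ‵ 1))
    ·' ⊢J2 (j2 ⊤' (N ∨' ◇ B) B)
    where
    N : Fm
    N = ¬' (A ⇒ ◇ B)

  J25ᵘ-emb : Derives L J2 → Derives L J5 → DerivesEmb L J25ᵘ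
  J25ᵘ-emb ⊢J2 ⊢J5 (j25ᵘ _ _) = J25ᵘ-of-J2-J5 ⊢J2 ⊢J5

-- Translating ▷ back into I

module Translation (X : Fmᵘ → Fmᵘ) where

  infix 5 _▷ˣ_
  _▷ˣ_ : Fmᵘ → Fmᵘ → Fmᵘ
  a ▷ˣ b = I b ∨ᵘ □ᵘ (a ⇒ᵘ X b)

  tr : Fm → Fmᵘ
  tr (var p) = var p
  tr ⊥'      = ⊥ᵘ
  tr (A ⇒ B) = tr A ⇒ᵘ tr B
  tr (□ A)   = □ᵘ (tr A)
  tr (A ▷ B) = tr A ▷ˣ tr B

  tr-eval : ∀ v A → eval (evalᵘ v ∘ tr) A ≡ evalᵘ v (tr A)
  tr-eval v (var p) = refl
  tr-eval v ⊥'      = refl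
  tr-eval v (A ⇒ B) = cong₂ (λ x y → not x ∨ y) (tr-eval v A) (tr-eval v B)
  tr-eval v (□ A)   = refl
  tr-eval v (A ▷ B) = refl

  Translates : Schemaᵘ → Schema → Set
  Translates ℓ Σ = ∀ {A} → Σ A → ℓ ⊢ᵘ tr A

  infixr 1 _∪ᵗ_
  _∪ᵗ_ : ∀ {ℓ Σ Σ′} → Translates ℓ Σ → Translates ℓ Σ′ → Translates ℓ (Σ ∪ Σ′)
  f ∪ᵗ g = [ f , g ]

  record Admissible (ℓ : Schemaᵘ) : Set where
    field
      X-mono : ∀ {a b} → ℓ ⊢ᵘ (a ⇒ᵘ b) → ℓ ⊢ᵘ (X a ⇒ᵘ X b)
      X⊥⇒⊥   : ℓ ⊢ᵘ (X ⊥ᵘ ⇒ᵘ ⊥ᵘ)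
      □X⇒I   : ∀ c → ℓ ⊢ᵘ (□ᵘ (⊤ᵘ ⇒ᵘ X c) ⇒ᵘ I c)

  module _ {ℓ : Schemaᵘ} (adm : Admissible ℓ) where
    open Admissible adm

    J3ˣ : ∀ a b c → ℓ ⊢ᵘ ((a ▷ˣ c) ∧ᵘ (b ▷ˣ c) ⇒ᵘ (a ∨ᵘ b) ▷ˣ c)
    J3ˣ a b c =
      tautᵘ (I c ∷ □ᵘ (a ⇒ᵘ X c) ∷ □ᵘ (b ⇒ᵘ X c) ∷ □ᵘ (a ∨ᵘ b ⇒ᵘ X c) ∷ [])
            ((‵ 1 ⟶ ‵ 2 ⟶ ‵ 3) ⟶ (‵ 0 ∨ₛ ‵ 1) ∧ₛ (‵ 0 ∨ₛ ‵ 2) ⟶ ‵ 0 ∨ₛ ‵ 3)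
      · □-mono₂ (tautᵘ (a ∷ b ∷ X c ∷ []) ((‵ 0 ⟶ ‵ 2) ⟶ (‵ 1 ⟶ ‵ 2) ⟶ ‵ 0 ∨ₛ ‵ 1 ⟶ ‵ 2))

    J6ˣ : ∀ a → ℓ ⊢ᵘ (□ᵘ a ⇔ᵘ (¬ᵘ a ▷ˣ ⊥ᵘ))
    J6ˣ a =
      tautᵘ (□ᵘ a ∷ I ⊥ᵘ ∷ □ᵘ ⊥ᵘ ∷ □ᵘ (¬ᵘ a ⇒ᵘ X ⊥ᵘ) ∷ [])
            ((‵ 1 ⟶ ‵ 2) ⟶ (‵ 2 ⟶ ‵ 0) ⟶ (‵ 0 ⟶ ‵ 3) ⟶ (‵ 3 ⟶ ‵ 0) ⟶ ‵ 0 ⇔ₛ ‵ 1 ∨ₛ ‵ 3)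
      · I⊥⇒□⊥
      · □-mono (tautᵘ (a ∷ []) (ff ⟶ ‵ 0))
      · □-mono (tautᵘ (a ∷ X ⊥ᵘ ∷ []) (‵ 0 ⟶ ¬ₛ ‵ 0 ⟶ ‵ 1))
      · □-mono (tautᵘ (a ∷ X ⊥ᵘ ∷ []) ((‵ 1 ⟶ ff) ⟶ (¬ₛ ‵ 0 ⟶ ‵ 1) ⟶ ‵ 0) · X⊥⇒⊥)

    ▷ˣ-monoʳ : ℓ ⊢ᵘ (a ⇒ᵘ b) → ℓ ⊢ᵘ (c ▷ˣ a ⇒ᵘ c ▷ˣ b)
    ▷ˣ-monoʳ {a} {b} {c} h =
      tautᵘ (I a ∷ I b ∷ □ᵘ (c ⇒ᵘ X a) ∷ □ᵘ (c ⇒ᵘ X b) ∷ []) ((‵ 0 ⟶ ‵ 1) ⟶ (‵ 2 ⟶ ‵ 3) ⟶ ‵ 0 ∨ₛ ‵ 2 ⟶ ‵ 1 ∨ₛ ‵ 3)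
      · Rᵘ h
      · □-mono (tautᵘ (c ∷ X a ∷ X b ∷ []) ((‵ 1 ⟶ ‵ 2) ⟶ (‵ 0 ⟶ ‵ 1) ⟶ ‵ 0 ⟶ ‵ 2) · X-mono h)

    ▷ˣ-antiˡ : ℓ ⊢ᵘ (a ⇒ᵘ b) → ℓ ⊢ᵘ (b ▷ˣ c ⇒ᵘ a ▷ˣ c)
    ▷ˣ-antiˡ {a} {b} {c} h =
      tautᵘ (I c ∷ □ᵘ (b ⇒ᵘ X c) ∷ □ᵘ (a ⇒ᵘ X c) ∷ []) ((‵ 1 ⟶ ‵ 2) ⟶ ‵ 0 ∨ₛ ‵ 1 ⟶ ‵ 0 ∨ₛ ‵ 2)
      · □-mono (tautᵘ (a ∷ b ∷ X c ∷ []) ((‵ 0 ⟶ ‵ 1) ⟶ (‵ 1 ⟶ ‵ 2) ⟶ ‵ 0 ⟶ ‵ 2) · h)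

    tr-sound : ∀ {L} → Translates ℓ L → L ⊢ A → ℓ ⊢ᵘ tr A
    tr-sound axs (taut {A} t) = taut (λ v → trans (sym (tr-eval v A)) (t _))
    tr-sound axs (G2 A B)     = G2 _ _
    tr-sound axs (G3 A)       = G3 _
    tr-sound axs (J3 A B C)   = J3ˣ _ _ _
    tr-sound axs (J6 A)       = J6ˣ _
    tr-sound axs (ax h)       = axs h
    tr-sound axs (mp d e)     = tr-sound axs d · tr-sound axs e
    tr-sound axs (nec d)      = nec (tr-sound axs d)
    tr-sound axs (R1 C d)     = ▷ˣ-monoʳ (tr-sound axs d)
    tr-sound axs (R2 C d)     = ▷ˣ-antiˡ (tr-sound axs d)

    tr-emb : ∀ a → ℓ ⊢ᵘ (tr (emb a) ⇒ᵘ a) × ℓ ⊢ᵘ (a ⇒ᵘ tr (emb a))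
    tr-emb (var p) = tautᵘ (var p ∷ []) (‵ 0 ⟶ ‵ 0) , tautᵘ (var p ∷ []) (‵ 0 ⟶ ‵ 0)
    tr-emb ⊥ᵘ      = tautᵘ [] (ff ⟶ ff) , tautᵘ [] (ff ⟶ ff)
    tr-emb (a ⇒ᵘ b) with tr-emb a | tr-emb b
    ... | a⁺⇒a , a⇒a⁺ | b⁺⇒b , b⇒b⁺ =
      (tautᵘ σ ((‵ 1 ⟶ ‵ 0) ⟶ (‵ 2 ⟶ ‵ 3) ⟶ (‵ 0 ⟶ ‵ 2) ⟶ ‵ 1 ⟶ ‵ 3) · a⇒a⁺ · b⁺⇒b) ,
      (tautᵘ σ ((‵ 0 ⟶ ‵ 1) ⟶ (‵ 3 ⟶ ‵ 2) ⟶ (‵ 1 ⟶ ‵ 3) ⟶ ‵ 0 ⟶ ‵ 2) · a⁺⇒a · b⇒b⁺)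
      where
      σ : Vec Fmᵘ 4
      σ = tr (emb a) ∷ a ∷ tr (emb b) ∷ b ∷ []
    tr-emb (□ᵘ a)  = □-mono (proj₁ (tr-emb a)) , □-mono (proj₂ (tr-emb a))
    tr-emb (I a)   =
      (tautᵘ σ ((‵ 0 ⟶ ‵ 1) ⟶ (‵ 2 ⟶ ‵ 0) ⟶ ‵ 0 ∨ₛ ‵ 2 ⟶ ‵ 1) · Rᵘ (proj₁ (tr-emb a)) · □X⇒I (tr (emb a))) ,
      (tautᵘ σ ((‵ 1 ⟶ ‵ 0) ⟶ ‵ 1 ⟶ ‵ 0 ∨ₛ ‵ 2) · Rᵘ (proj₂ (tr-emb a)))
      where
      σ : Vec Fmᵘ 3
      σ = I (tr (emb a)) ∷ I a ∷ □ᵘ (⊤ᵘ ⇒ᵘ X (tr (emb a))) ∷ []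

  agree : ∀ {L ℓ} → Admissible ℓ → Translates ℓ L → DerivesEmb L ℓ → Agree L ℓ
  agree adm axs embs a = (λ d → proj₁ (tr-emb adm a) · tr-sound adm axs d) , emb-sound embs

  module _ (ℓ : Schemaᵘ) where

    Inflationary Above-◇ ◇-Reflecting I-Collapsing : Set
    Inflationary  = ∀ a → ℓ ⊢ᵘ (a ⇒ᵘ X a)
    Above-◇       = ∀ a → ℓ ⊢ᵘ (◇ᵘ a ⇒ᵘ X a)
    ◇-Reflecting  = ∀ a → ℓ ⊢ᵘ (◇ᵘ (X a) ⇒ᵘ ◇ᵘ a)
    I-Collapsing  = ∀ a → ℓ ⊢ᵘ (I (a ∨ᵘ X a) ⇒ᵘ I a)

    □-Monotone Absorbing : Set
    □-Monotone = ∀ a b → ℓ ⊢ᵘ (□ᵘ (a ⇒ᵘ b) ⇒ᵘ □ᵘ (X a ⇒ᵘ X b))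
    Absorbing  = ∀ b c → ℓ ⊢ᵘ (□ᵘ (b ⇒ᵘ X c) ⇒ᵘ □ᵘ (X (b ∨ᵘ c) ⇒ᵘ X c))

    -- Composing a ▷ˣ b with b ▷ˣ c when the latter holds through its □ disjunct.
    Bridging Transitive : Set
    Bridging   = ∀ a b c → ℓ ⊢ᵘ (I b ⇒ᵘ □ᵘ (b ⇒ᵘ X c) ⇒ᵘ a ▷ˣ c)
    Transitive = ∀ a b c → ℓ ⊢ᵘ (□ᵘ (a ⇒ᵘ X b) ⇒ᵘ □ᵘ (b ⇒ᵘ X c) ⇒ᵘ □ᵘ (a ⇒ᵘ X c))

  module _ {ℓ : Schemaᵘ} where

    J1ˣ : Inflationary ℓ → ∀ a b → ℓ ⊢ᵘ (□ᵘ (a ⇒ᵘ b) ⇒ᵘ a ▷ˣ b)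
    J1ˣ infl a b =
      tautᵘ (□ᵘ (a ⇒ᵘ b) ∷ I b ∷ □ᵘ (a ⇒ᵘ X b) ∷ []) ((‵ 0 ⟶ ‵ 2) ⟶ ‵ 0 ⟶ ‵ 1 ∨ₛ ‵ 2)
      · □-mono (tautᵘ (a ∷ b ∷ X b ∷ []) ((‵ 1 ⟶ ‵ 2) ⟶ (‵ 0 ⟶ ‵ 1) ⟶ ‵ 0 ⟶ ‵ 2) · infl b)

    J5ˣ : Above-◇ ℓ → ∀ a → ℓ ⊢ᵘ (◇ᵘ a ▷ˣ a)
    J5ˣ above a = tautᵘ (I a ∷ □ᵘ (◇ᵘ a ⇒ᵘ X a) ∷ []) (‵ 1 ⟶ ‵ 0 ∨ₛ ‵ 1) · nec (above a)

    J4₊ˣ : Derivesᵘ ℓ I2 → □-Monotone ℓ → ∀ a b c → ℓ ⊢ᵘ (□ᵘ (a ⇒ᵘ b) ⇒ᵘ c ▷ˣ a ⇒ᵘ c ▷ˣ b)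
    J4₊ˣ ⊢I2 mono a b c =
      tautᵘ (□ᵘ (a ⇒ᵘ b) ∷ I a ∷ I b ∷ □ᵘ (X a ⇒ᵘ X b) ∷ □ᵘ (c ⇒ᵘ X a) ∷ □ᵘ (c ⇒ᵘ X b) ∷ [])
            ((‵ 0 ⟶ ‵ 1 ⟶ ‵ 2) ⟶ (‵ 0 ⟶ ‵ 3) ⟶ (‵ 3 ⟶ ‵ 4 ⟶ ‵ 5) ⟶ ‵ 0 ⟶ ‵ 1 ∨ₛ ‵ 4 ⟶ ‵ 2 ∨ₛ ‵ 5)
      · ⊢I2 (i2 a b)
      · mono a b
      · □-mono₂ (tautᵘ (c ∷ X a ∷ X b ∷ []) ((‵ 1 ⟶ ‵ 2) ⟶ (‵ 0 ⟶ ‵ 1) ⟶ ‵ 0 ⟶ ‵ 2))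

    J2₊ˣ : Derivesᵘ ℓ I2 → I-Collapsing ℓ → Absorbing ℓ →
           ∀ a b c → ℓ ⊢ᵘ ((a ▷ˣ b ∨ᵘ c) ∧ᵘ (b ▷ˣ c) ⇒ᵘ a ▷ˣ c)
    J2₊ˣ ⊢I2 collapse absorb a b c =
      tautᵘ (I (b ∨ᵘ c) ∷ □ᵘ (a ⇒ᵘ X (b ∨ᵘ c)) ∷ I c ∷ □ᵘ (b ⇒ᵘ X c) ∷ □ᵘ (b ∨ᵘ c ⇒ᵘ c ∨ᵘ X c)
               ∷ I (c ∨ᵘ X c) ∷ □ᵘ (X (b ∨ᵘ c) ⇒ᵘ X c) ∷ □ᵘ (a ⇒ᵘ X c) ∷ [])
            ((‵ 3 ⟶ ‵ 4) ⟶ (‵ 4 ⟶ ‵ 0 ⟶ ‵ 5) ⟶ (‵ 5 ⟶ ‵ 2) ⟶ (‵ 3 ⟶ ‵ 6) ⟶ (‵ 1 ⟶ ‵ 6 ⟶ ‵ 7)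
             ⟶ (‵ 0 ∨ₛ ‵ 1) ∧ₛ (‵ 2 ∨ₛ ‵ 3) ⟶ ‵ 2 ∨ₛ ‵ 7)
      · □-mono (tautᵘ (b ∷ c ∷ X c ∷ []) ((‵ 0 ⟶ ‵ 2) ⟶ ‵ 0 ∨ₛ ‵ 1 ⟶ ‵ 1 ∨ₛ ‵ 2))
      · ⊢I2 (i2 (b ∨ᵘ c) (c ∨ᵘ X c))
      · collapse c
      · absorb b c
      · □-mono₂ (tautᵘ (a ∷ X (b ∨ᵘ c) ∷ X c ∷ []) ((‵ 0 ⟶ ‵ 1) ⟶ (‵ 1 ⟶ ‵ 2) ⟶ ‵ 0 ⟶ ‵ 2))

    J2ˣ : Bridging ℓ → Transitive ℓ → ∀ a b c → ℓ ⊢ᵘ ((a ▷ˣ b) ∧ᵘ (b ▷ˣ c) ⇒ᵘ a ▷ˣ c)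
    J2ˣ bridge compose a b c =
      tautᵘ (I b ∷ □ᵘ (a ⇒ᵘ X b) ∷ I c ∷ □ᵘ (b ⇒ᵘ X c) ∷ □ᵘ (a ⇒ᵘ X c) ∷ [])
            ((‵ 0 ⟶ ‵ 3 ⟶ ‵ 2 ∨ₛ ‵ 4) ⟶ (‵ 1 ⟶ ‵ 3 ⟶ ‵ 4) ⟶ (‵ 0 ∨ₛ ‵ 1) ∧ₛ (‵ 2 ∨ₛ ‵ 3) ⟶ ‵ 2 ∨ₛ ‵ 4)
      · bridge a b c
      · compose a b c

    J4ˣ : Derivesᵘ ℓ I4 → ◇-Reflecting ℓ → ∀ a b → ℓ ⊢ᵘ (a ▷ˣ b ⇒ᵘ ◇ᵘ a ⇒ᵘ ◇ᵘ b)
    J4ˣ ⊢I4 reflect a b =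
      tautᵘ (I b ∷ □ᵘ (a ⇒ᵘ X b) ∷ ◇ᵘ a ∷ ◇ᵘ b ∷ ◇ᵘ ⊤ᵘ ∷ ◇ᵘ (X b) ∷ [])
            ((‵ 0 ∧ₛ ‵ 4 ⟶ ‵ 3) ⟶ (‵ 2 ⟶ ‵ 4) ⟶ (‵ 1 ⟶ ‵ 2 ⟶ ‵ 5) ⟶ (‵ 5 ⟶ ‵ 3) ⟶ ‵ 0 ∨ₛ ‵ 1 ⟶ ‵ 2 ⟶ ‵ 3)
      · ⊢I4 (i4 b)
      · ◇-mono (tautᵘ (a ∷ []) (‵ 0 ⟶ ¬ₛ ff))
      · ◇-K a (X b)
      · reflect b

    J1-tr : Inflationary ℓ → Translates ℓ J1
    J1-tr infl (j1 A B) = J1ˣ infl (tr A) (tr B)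

    J5-tr : Above-◇ ℓ → Translates ℓ J5
    J5-tr above (j5 A) = J5ˣ above (tr A)

    J4₊-tr : Derivesᵘ ℓ I2 → □-Monotone ℓ → Translates ℓ J4₊
    J4₊-tr ⊢I2 mono (j4₊ A B C) = J4₊ˣ ⊢I2 mono (tr A) (tr B) (tr C)

    J2₊-tr : Derivesᵘ ℓ I2 → I-Collapsing ℓ → Absorbing ℓ → Translates ℓ J2₊
    J2₊-tr ⊢I2 collapse absorb (j2₊ A B C) = J2₊ˣ ⊢I2 collapse absorb (tr A) (tr B) (tr C)

    J2-tr : Bridging ℓ → Transitive ℓ → Translates ℓ J2
    J2-tr bridge compose (j2 A B C) = J2ˣ bridge compose (tr A) (tr B) (tr C)

    J4-tr : Derivesᵘ ℓ I4 → ◇-Reflecting ℓ → Translates ℓ J4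
    J4-tr ⊢I4 reflect (j4 A B) = J4ˣ ⊢I4 reflect (tr A) (tr B)

-- The four choices of X

module Const⊥ {ℓ : Schemaᵘ} where
  open Translation (const ⊥ᵘ)

  admissible : Admissible ℓ
  admissible = record
    { X-mono = λ _ → tautᵘ [] (ff ⟶ ff)
    ; X⊥⇒⊥   = tautᵘ [] (ff ⟶ ff)
    ; □X⇒I   = λ c → ⇒-trans (□-mono (tautᵘ [] (¬ₛ ¬ₛ ff ⟶ ff))) (□⊥⇒I c)
    }

  □-monotone : □-Monotone ℓ
  □-monotone a b = □-mono (tautᵘ (a ∷ b ∷ []) ((‵ 0 ⟶ ‵ 1) ⟶ ff ⟶ ff))

  i-collapsing : I-Collapsing ℓ
  i-collapsing a = Rᵘ (tautᵘ (a ∷ []) (‵ 0 ∨ₛ ff ⟶ ‵ 0))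

  absorbing : Absorbing ℓ
  absorbing b c = □-mono (tautᵘ (b ∷ []) ((‵ 0 ⟶ ff) ⟶ ff ⟶ ff))

  transitive : Transitive ℓ
  transitive a b c = tautᵘ (□ᵘ (¬ᵘ a) ∷ □ᵘ (¬ᵘ b) ∷ []) (‵ 0 ⟶ ‵ 1 ⟶ ‵ 0)

  -- In both versions I b and □¬b force □⊥, hence □¬a.
  bridging-I4 : Derivesᵘ ℓ I4 → Bridging ℓ
  bridging-I4 ⊢I4 a b c =
    tautᵘ (I b ∷ □ᵘ (¬ᵘ b) ∷ I c ∷ □ᵘ (¬ᵘ a) ∷ □ᵘ (¬ᵘ ⊤ᵘ) ∷ □ᵘ ⊥ᵘ ∷ [])
          ((‵ 0 ∧ₛ ¬ₛ ‵ 4 ⟶ ¬ₛ ‵ 1) ⟶ (‵ 4 ⟶ ‵ 5) ⟶ (‵ 5 ⟶ ‵ 3) ⟶ ‵ 0 ⟶ ‵ 1 ⟶ ‵ 2 ∨ₛ ‵ 3)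
    · ⊢I4 (i4 b)
    · □-mono (tautᵘ [] (¬ₛ ¬ₛ ff ⟶ ff))
    · □-mono (tautᵘ (a ∷ []) (ff ⟶ ¬ₛ ‵ 0))

  bridging-I2 : Derivesᵘ ℓ I2 → Bridging ℓ
  bridging-I2 ⊢I2 a b c =
    tautᵘ (I b ∷ □ᵘ (¬ᵘ b) ∷ I c ∷ □ᵘ (¬ᵘ a) ∷ I ⊥ᵘ ∷ □ᵘ ⊥ᵘ ∷ [])
          ((‵ 1 ⟶ ‵ 0 ⟶ ‵ 4) ⟶ (‵ 4 ⟶ ‵ 5) ⟶ (‵ 5 ⟶ ‵ 3) ⟶ ‵ 0 ⟶ ‵ 1 ⟶ ‵ 2 ∨ₛ ‵ 3)
    · ⊢I2 (i2 b ⊥ᵘ)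
    · I⊥⇒□⊥
    · □-mono (tautᵘ (a ∷ []) (ff ⟶ ¬ₛ ‵ 0))

  ◇-reflecting : ◇-Reflecting ℓ
  ◇-reflecting a = ◇-mono (tautᵘ (a ∷ []) (ff ⟶ ‵ 0))

module Id {ℓ : Schemaᵘ} where
  open Translation id

  admissible : Derivesᵘ ℓ J1ᵘ → Admissible ℓ
  admissible ⊢J1ᵘ = record
    { X-mono = λ h → h
    ; X⊥⇒⊥   = tautᵘ [] (ff ⟶ ff)
    ; □X⇒I   = λ c → ⇒-trans (□-mono (tautᵘ (c ∷ []) ((¬ₛ ff ⟶ ‵ 0) ⟶ ‵ 0))) (⊢J1ᵘ (j1ᵘ c))
    }

  inflationary : Inflationary ℓ
  inflationary a = tautᵘ (a ∷ []) (‵ 0 ⟶ ‵ 0)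

  □-monotone : □-Monotone ℓ
  □-monotone a b = tautᵘ (□ᵘ (a ⇒ᵘ b) ∷ []) (‵ 0 ⟶ ‵ 0)

  i-collapsing : I-Collapsing ℓ
  i-collapsing a = Rᵘ (tautᵘ (a ∷ []) (‵ 0 ∨ₛ ‵ 0 ⟶ ‵ 0))

  absorbing : Absorbing ℓ
  absorbing b c = □-mono (tautᵘ (b ∷ c ∷ []) ((‵ 0 ⟶ ‵ 1) ⟶ ‵ 0 ∨ₛ ‵ 1 ⟶ ‵ 1))

  ◇-reflecting : ◇-Reflecting ℓ
  ◇-reflecting a = tautᵘ (◇ᵘ a ∷ []) (‵ 0 ⟶ ‵ 0)

module Diamond {ℓ : Schemaᵘ} where
  open Translation ◇ᵘ

  admissible : Admissible ℓ
  admissible = record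
    { X-mono = ◇-mono
    ; X⊥⇒⊥   = ¬◇⊥
    ; □X⇒I   = λ c → ⇒-trans (⇒-trans (□-mono (tautᵘ (◇ᵘ c ∷ []) ((¬ₛ ff ⟶ ‵ 0) ⟶ ‵ 0))) (□◇⇒□⊥ c)) (□⊥⇒I c)
    }

  above-◇ : Above-◇ ℓ
  above-◇ a = tautᵘ (◇ᵘ a ∷ []) (‵ 0 ⟶ ‵ 0)

  □-monotone : □-Monotone ℓ
  □-monotone a b =
    □-mono-4 (tautᵘ ((a ⇒ᵘ b) ∷ □ᵘ (a ⇒ᵘ b) ∷ ◇ᵘ a ∷ ◇ᵘ b ∷ []) ((‵ 1 ⟶ ‵ 2 ⟶ ‵ 3) ⟶ ‵ 0 ⟶ ‵ 1 ⟶ ‵ 2 ⟶ ‵ 3)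
              · ◇-K a b)

  ◇-lift : ∀ b c → ℓ ⊢ᵘ (□ᵘ (b ⇒ᵘ ◇ᵘ c) ⇒ᵘ □ᵘ (◇ᵘ b ⇒ᵘ ◇ᵘ c))
  ◇-lift b c =
    □-mono-4 (tautᵘ ((b ⇒ᵘ ◇ᵘ c) ∷ □ᵘ (b ⇒ᵘ ◇ᵘ c) ∷ ◇ᵘ b ∷ ◇ᵘ (◇ᵘ c) ∷ ◇ᵘ c ∷ [])
                    ((‵ 1 ⟶ ‵ 2 ⟶ ‵ 3) ⟶ (‵ 3 ⟶ ‵ 4) ⟶ ‵ 0 ⟶ ‵ 1 ⟶ ‵ 2 ⟶ ‵ 4)
              · ◇-K b (◇ᵘ c) · ◇-4 c)

  i-collapsing : Derivesᵘ ℓ I3 → I-Collapsing ℓ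
  i-collapsing ⊢I3 a = ⊢I3 (i3 a)

  absorbing : Absorbing ℓ
  absorbing b c =
    ⇒-trans (◇-lift b c)
            (□-mono (tautᵘ (◇ᵘ (b ∨ᵘ c) ∷ ◇ᵘ b ∷ ◇ᵘ c ∷ []) ((‵ 0 ⟶ ‵ 1 ∨ₛ ‵ 2) ⟶ (‵ 1 ⟶ ‵ 2) ⟶ ‵ 0 ⟶ ‵ 2)
                     · ◇-∨ b c))

  transitive : Transitive ℓ
  transitive a b c =
    tautᵘ (□ᵘ (a ⇒ᵘ ◇ᵘ b) ∷ □ᵘ (b ⇒ᵘ ◇ᵘ c) ∷ □ᵘ (◇ᵘ b ⇒ᵘ ◇ᵘ c) ∷ □ᵘ (a ⇒ᵘ ◇ᵘ c) ∷ [])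
          ((‵ 1 ⟶ ‵ 2) ⟶ (‵ 0 ⟶ ‵ 2 ⟶ ‵ 3) ⟶ ‵ 0 ⟶ ‵ 1 ⟶ ‵ 3)
    · ◇-lift b c
    · □-mono₂ (tautᵘ (a ∷ ◇ᵘ b ∷ ◇ᵘ c ∷ []) ((‵ 0 ⟶ ‵ 1) ⟶ (‵ 1 ⟶ ‵ 2) ⟶ ‵ 0 ⟶ ‵ 2))

  bridging : Derivesᵘ ℓ J25ᵘ → Bridging ℓ
  bridging ⊢J25ᵘ a b c =
    tautᵘ (I b ∷ □ᵘ (b ⇒ᵘ ◇ᵘ c) ∷ I c ∷ □ᵘ (a ⇒ᵘ ◇ᵘ c) ∷ []) ((‵ 1 ⟶ ‵ 0 ⟶ ‵ 2) ⟶ ‵ 0 ⟶ ‵ 1 ⟶ ‵ 2 ∨ₛ ‵ 3)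
    · ⊢J25ᵘ (j25ᵘ b c)

  ◇-reflecting : ◇-Reflecting ℓ
  ◇-reflecting = ◇-4

◇ʳ : Fmᵘ → Fmᵘ
◇ʳ a = a ∨ᵘ ◇ᵘ a

J15ᵘ-of-J1ᵘ-I3 : ∀ {ℓ} → Derivesᵘ ℓ J1ᵘ → Derivesᵘ ℓ I3 → Derivesᵘ ℓ J15ᵘ
J15ᵘ-of-J1ᵘ-I3 ⊢J1ᵘ ⊢I3 (j15ᵘ a) = ⇒-trans (⊢J1ᵘ (j1ᵘ (◇ʳ a))) (⊢I3 (i3 a))

module ReflDiamond {ℓ : Schemaᵘ} where
  open Translation ◇ʳ

  admissible : Derivesᵘ ℓ J15ᵘ → Admissible ℓ
  admissible ⊢J15ᵘ = record
    { X-mono = λ {a} {b} h →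
        tautᵘ (a ∷ b ∷ ◇ᵘ a ∷ ◇ᵘ b ∷ []) ((‵ 0 ⟶ ‵ 1) ⟶ (‵ 2 ⟶ ‵ 3) ⟶ ‵ 0 ∨ₛ ‵ 2 ⟶ ‵ 1 ∨ₛ ‵ 3) · h · ◇-mono h
    ; X⊥⇒⊥   = tautᵘ (◇ᵘ ⊥ᵘ ∷ []) ((‵ 0 ⟶ ff) ⟶ ff ∨ₛ ‵ 0 ⟶ ff) · ¬◇⊥
    ; □X⇒I   = λ c → ⇒-trans (□-mono (tautᵘ (◇ʳ c ∷ []) ((¬ₛ ff ⟶ ‵ 0) ⟶ ‵ 0))) (⊢J15ᵘ (j15ᵘ c))
    }

  inflationary : Inflationary ℓ
  inflationary a = tautᵘ (a ∷ ◇ᵘ a ∷ []) (‵ 0 ⟶ ‵ 0 ∨ₛ ‵ 1)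

  above-◇ : Above-◇ ℓ
  above-◇ a = tautᵘ (a ∷ ◇ᵘ a ∷ []) (‵ 1 ⟶ ‵ 0 ∨ₛ ‵ 1)

  □-monotone : □-Monotone ℓ
  □-monotone a b =
    □-mono-4 (tautᵘ (a ∷ b ∷ □ᵘ (a ⇒ᵘ b) ∷ ◇ᵘ a ∷ ◇ᵘ b ∷ [])
                    ((‵ 2 ⟶ ‵ 3 ⟶ ‵ 4) ⟶ (‵ 0 ⟶ ‵ 1) ⟶ ‵ 2 ⟶ ‵ 0 ∨ₛ ‵ 3 ⟶ ‵ 1 ∨ₛ ‵ 4)
              · ◇-K a b)

  i-collapsing : Derivesᵘ ℓ I3 → I-Collapsing ℓ
  i-collapsing ⊢I3 a = ⇒-trans (Rᵘ (tautᵘ (a ∷ ◇ᵘ a ∷ []) (‵ 0 ∨ₛ (‵ 0 ∨ₛ ‵ 1) ⟶ ‵ 0 ∨ₛ ‵ 1))) (⊢I3 (i3 a))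

  absorbing : Absorbing ℓ
  absorbing b c =
    □-mono-4 (tautᵘ (b ∷ c ∷ ◇ᵘ c ∷ □ᵘ (b ⇒ᵘ ◇ʳ c) ∷ ◇ᵘ (b ∨ᵘ c) ∷ ◇ᵘ b ∷ ◇ᵘ (◇ʳ c) ∷ ◇ᵘ (◇ᵘ c) ∷ [])
                    ((‵ 4 ⟶ ‵ 5 ∨ₛ ‵ 2) ⟶ (‵ 3 ⟶ ‵ 5 ⟶ ‵ 6) ⟶ (‵ 6 ⟶ ‵ 2 ∨ₛ ‵ 7) ⟶ (‵ 7 ⟶ ‵ 2)
                     ⟶ (‵ 0 ⟶ ‵ 1 ∨ₛ ‵ 2) ⟶ ‵ 3 ⟶ (‵ 0 ∨ₛ ‵ 1) ∨ₛ ‵ 4 ⟶ ‵ 1 ∨ₛ ‵ 2)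
              · ◇-∨ b c · ◇-K b (◇ʳ c) · ◇-∨ c (◇ᵘ c) · ◇-4 c)

  ◇-reflecting : ◇-Reflecting ℓ
  ◇-reflecting a =
    tautᵘ (◇ᵘ (◇ʳ a) ∷ ◇ᵘ a ∷ ◇ᵘ (◇ᵘ a) ∷ []) ((‵ 0 ⟶ ‵ 1 ∨ₛ ‵ 2) ⟶ (‵ 2 ⟶ ‵ 1) ⟶ ‵ 0 ⟶ ‵ 1)
    · ◇-∨ a (◇ᵘ a) · ◇-4 a

IL⁻∼il⁻ : Agree IL⁻ il⁻
IL⁻∼il⁻ = agree Const⊥.admissible (λ ()) (λ ())
  where open Translation (const ⊥ᵘ)

J5∼il⁻ : Agree J5 il⁻
J5∼il⁻ = agree Diamond.admissible (J5-tr Diamond.above-◇) (λ ())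
  where open Translation ◇ᵘ

J1∼J1ᵘ : Agree J1 J1ᵘ
J1∼J1ᵘ = agree (Id.admissible ax) (J1-tr Id.inflationary) (J1ᵘ-emb ax)
  where open Translation id

J4₊∼I2 : Agree J4₊ I2
J4₊∼I2 = agree Const⊥.admissible (J4₊-tr ax Const⊥.□-monotone) (I2-emb-J4₊ ax)
  where open Translation (const ⊥ᵘ)

J4₊∪J5∼I2 : Agree (J4₊ ∪ J5) I2
J4₊∪J5∼I2 = agree Diamond.admissible
  (J4₊-tr ax Diamond.□-monotone ∪ᵗ J5-tr Diamond.above-◇)
  (I2-emb-J4₊ (axiom inj₁))
  where open Translation ◇ᵘ

J2₊∼I2 : Agree J2₊ I2
J2₊∼I2 = agree Const⊥.admissible (J2₊-tr ax Const⊥.i-collapsing Const⊥.absorbing) (I2-emb-J2₊ ax)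
  where open Translation (const ⊥ᵘ)

J2∪J4₊∼I2 : Agree (J2 ∪ J4₊) I2
J2∪J4₊∼I2 = agree Const⊥.admissible
  (J2-tr (Const⊥.bridging-I2 ax) Const⊥.transitive ∪ᵗ J4₊-tr ax Const⊥.□-monotone)
  (I2-emb-J4₊ (axiom inj₂))
  where open Translation (const ⊥ᵘ)

J1∪J5∼J15ᵘ : Agree (J1 ∪ J5) J15ᵘ
J1∪J5∼J15ᵘ = agree (ReflDiamond.admissible ax)
  (J1-tr ReflDiamond.inflationary ∪ᵗ J5-tr ReflDiamond.above-◇)
  (J15ᵘ-emb (axiom inj₁) (axiom inj₂))
  where open Translation ◇ʳ

J1∪J4₊∼J1ᵘ∪I2 : Agree (J1 ∪ J4₊) (J1ᵘ ∪ I2)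
J1∪J4₊∼J1ᵘ∪I2 = agree (Id.admissible (axiomᵘ inj₁))
  (J1-tr Id.inflationary ∪ᵗ J4₊-tr (axiomᵘ inj₂) Id.□-monotone)
  (J1ᵘ-emb (axiom inj₁) ∪ᵉ I2-emb-J4₊ (axiom inj₂))
  where open Translation id

CL∼J1ᵘ∪I2 : Agree CL (J1ᵘ ∪ I2)
CL∼J1ᵘ∪I2 = agree (Id.admissible (axiomᵘ inj₁))
  (J1-tr Id.inflationary ∪ᵗ J2₊-tr (axiomᵘ inj₂) Id.i-collapsing Id.absorbing)
  (J1ᵘ-emb (axiom inj₁) ∪ᵉ I2-emb-J2₊ (axiom inj₂))
  where open Translation id

J1∪J4₊∪J5∼J15ᵘ∪I2 : Agree (J1 ∪ J4₊ ∪ J5) (J15ᵘ ∪ I2)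
J1∪J4₊∪J5∼J15ᵘ∪I2 = agree (ReflDiamond.admissible (axiomᵘ inj₁))
  (J1-tr ReflDiamond.inflationary
   ∪ᵗ J4₊-tr (axiomᵘ inj₂) ReflDiamond.□-monotone
   ∪ᵗ J5-tr ReflDiamond.above-◇)
  (J15ᵘ-emb (axiom inj₁) (axiom (inj₂ ∘ inj₂)) ∪ᵉ I2-emb-J4₊ (axiom (inj₂ ∘ inj₁)))
  where open Translation ◇ʳ

J2₊∪J5∼I2∪I3 : Agree (J2₊ ∪ J5) (I2 ∪ I3)
J2₊∪J5∼I2∪I3 = agree Diamond.admissible
  (J2₊-tr (axiomᵘ inj₁) (Diamond.i-collapsing (axiomᵘ inj₂)) Diamond.absorbing ∪ᵗ J5-tr Diamond.above-◇)
  (I2-emb-J2₊ (axiom inj₁) ∪ᵉ I3-emb (axiom inj₁) (axiom inj₂))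
  where open Translation ◇ᵘ

IL∼J1ᵘ∪I2∪I3 : Agree IL (J1ᵘ ∪ I2 ∪ I3)
IL∼J1ᵘ∪I2∪I3 = agree (ReflDiamond.admissible (J15ᵘ-of-J1ᵘ-I3 (axiomᵘ inj₁) (axiomᵘ (inj₂ ∘ inj₂))))
  (J1-tr ReflDiamond.inflationary
   ∪ᵗ J2₊-tr (axiomᵘ (inj₂ ∘ inj₁)) (ReflDiamond.i-collapsing (axiomᵘ (inj₂ ∘ inj₂))) ReflDiamond.absorbing
   ∪ᵗ J5-tr ReflDiamond.above-◇)
  (J1ᵘ-emb (axiom inj₁)
   ∪ᵉ I2-emb-J2₊ (axiom (inj₂ ∘ inj₁))
   ∪ᵉ I3-emb (axiom (inj₂ ∘ inj₁)) (axiom (inj₂ ∘ inj₂)))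
  where open Translation ◇ʳ

J4∼I4 : Agree J4 I4
J4∼I4 = agree Const⊥.admissible (J4-tr ax Const⊥.◇-reflecting) (I4-emb-J4 ax)
  where open Translation (const ⊥ᵘ)

J4∪J5∼I4 : Agree (J4 ∪ J5) I4
J4∪J5∼I4 = agree Diamond.admissible
  (J4-tr ax Diamond.◇-reflecting ∪ᵗ J5-tr Diamond.above-◇)
  (I4-emb-J4 (axiom inj₁))
  where open Translation ◇ᵘ

J2∼I4 : Agree J2 I4
J2∼I4 = agree Const⊥.admissible (J2-tr (Const⊥.bridging-I4 ax) Const⊥.transitive) (I4-emb-J2 ax)
  where open Translation (const ⊥ᵘ)

J1∪J4∼J1ᵘ∪I4 : Agree (J1 ∪ J4) (J1ᵘ ∪ I4)
J1∪J4∼J1ᵘ∪I4 = agree (Id.admissible (axiomᵘ inj₁))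
  (J1-tr Id.inflationary ∪ᵗ J4-tr (axiomᵘ inj₂) Id.◇-reflecting)
  (J1ᵘ-emb (axiom inj₁) ∪ᵉ I4-emb-J4 (axiom inj₂))
  where open Translation id

J1∪J4∪J5∼J15ᵘ∪I4 : Agree (J1 ∪ J4 ∪ J5) (J15ᵘ ∪ I4)
J1∪J4∪J5∼J15ᵘ∪I4 = agree (ReflDiamond.admissible (axiomᵘ inj₁))
  (J1-tr ReflDiamond.inflationary
   ∪ᵗ J4-tr (axiomᵘ inj₂) ReflDiamond.◇-reflecting
   ∪ᵗ J5-tr ReflDiamond.above-◇)
  (J15ᵘ-emb (axiom inj₁) (axiom (inj₂ ∘ inj₂)) ∪ᵉ I4-emb-J4 (axiom (inj₂ ∘ inj₁)))
  where open Translation ◇ʳ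

J2∪J5∼J25ᵘ∪I4 : Agree (J2 ∪ J5) (J25ᵘ ∪ I4)
J2∪J5∼J25ᵘ∪I4 = agree Diamond.admissible
  (J2-tr (Diamond.bridging (axiomᵘ inj₁)) Diamond.transitive ∪ᵗ J5-tr Diamond.above-◇)
  (J25ᵘ-emb (axiom inj₁) (axiom inj₂) ∪ᵉ I4-emb-J2 (axiom inj₁))
  where open Translation ◇ᵘ

J2∪J4₊∪J5∼I2∪J25ᵘ : Agree (J2 ∪ J4₊ ∪ J5) (I2 ∪ J25ᵘ)
J2∪J4₊∪J5∼I2∪J25ᵘ = agree Diamond.admissible
  (J2-tr (Diamond.bridging (axiomᵘ inj₂)) Diamond.transitive
   ∪ᵗ J4₊-tr (axiomᵘ inj₁) Diamond.□-monotone
   ∪ᵗ J5-tr Diamond.above-◇)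
  (I2-emb-J4₊ (axiom (inj₂ ∘ inj₁)) ∪ᵉ J25ᵘ-emb (axiom inj₁) (axiom (inj₂ ∘ inj₂)))
  where open Translation ◇ᵘ

theorem3p5 :
  (Agree IL⁻ il⁻ × Agree J5 il⁻) ×
  Agree J1 J1ᵘ ×
  (Agree J4₊ I2 × Agree (J4₊ ∪ J5) I2 × Agree J2₊ I2 × Agree (J2 ∪ J4₊) I2) ×
  Agree (J1 ∪ J5) J15ᵘ ×
  (Agree (J1 ∪ J4₊) (J1ᵘ ∪ I2) × Agree CL (J1ᵘ ∪ I2)) ×
  Agree (J1 ∪ J4₊ ∪ J5) (J15ᵘ ∪ I2) ×
  Agree (J2₊ ∪ J5) (I2 ∪ I3) ×
  Agree IL (J1ᵘ ∪ I2 ∪ I3) ×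
  (Agree J4 I4 × Agree (J4 ∪ J5) I4 × Agree J2 I4) ×
  Agree (J1 ∪ J4) (J1ᵘ ∪ I4) ×
  Agree (J1 ∪ J4 ∪ J5) (J15ᵘ ∪ I4) ×
  Agree (J2 ∪ J5) (J25ᵘ ∪ I4) ×
  Agree (J2 ∪ J4₊ ∪ J5) (I2 ∪ J25ᵘ)
theorem3p5 =
  (IL⁻∼il⁻ , J5∼il⁻) ,
  J1∼J1ᵘ ,
  (J4₊∼I2 , J4₊∪J5∼I2 , J2₊∼I2 , J2∪J4₊∼I2) ,
  J1∪J5∼J15ᵘ ,
  (J1∪J4₊∼J1ᵘ∪I2 , CL∼J1ᵘ∪I2) ,
  J1∪J4₊∪J5∼J15ᵘ∪I2 ,
  J2₊∪J5∼I2∪I3 ,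
  IL∼J1ᵘ∪I2∪I3 ,
  (J4∼I4 , J4∪J5∼I4 , J2∼I4) ,
  J1∪J4∼J1ᵘ∪I4 ,
  J1∪J4∪J5∼J15ᵘ∪I4 ,
  J2∪J5∼J25ᵘ∪I4 ,
  J2∪J4₊∪J5∼I2∪J25ᵘ
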